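{- Let $(x,y,z)$ be a primitive Pythagorean triple with $y$ even, in which all three components $x,y,z$ are numeric palindromes. Then either the first and last decimal digits of $x$ are both $5$, or the first and last decimal digits of $z$ are both $5$.
   Context: A Pythagorean triple is a triple $(x,y,z)$ of positive integers with $x^2+y^2=z^2$; it is primitive if $\gcd(x,y,z)=1$ (in which case exactly one of $x,y$ is even). A numeric palindrome is a positive integer whose decimal representation (without leading zeros) reads the same forwards and backwards. -}

module Defs where

open import Data.Nat using (ℕ; zero; suc; _+_; _*_; _<_)
open import Data.Nat.DivMod using (_/_; _%_)
open import Data.Nat.GCD using (gcd)
open import Data.List using (List; []; _∷_; reverse; head; last)
open import Data.Maybe using (Maybe; just)
open import Data.Product using (_×_)
open import Relation.Binary.PropositionalEquality using (_≡_)

-- Decimal digits, least significant first, without leading zeros.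
-- Fuel-based: n steps of division by 10 always suffice for n.
digitsAux : ℕ → ℕ → List ℕ
digitsAux zero    _ = []
digitsAux (suc f) zero = []
digitsAux (suc f) n@(suc _) = (n % 10) ∷ digitsAux f (n / 10)

digits : ℕ → List ℕ
digits n = digitsAux n n

IsPalindrome : ℕ → Set
IsPalindrome n = (0 < n) × (reverse (digits n) ≡ digits n)

lastDigit : ℕ → Maybe ℕ
lastDigit n = head (digits n)

firstDigit : ℕ → Maybe ℕ
firstDigit n = last (digits n)

IsPrimitivePythagoreanTriple : ℕ → ℕ → ℕ → Set
IsPrimitivePythagoreanTriple x y z =
  (0 < x) × (0 < y) × (0 < z) × (x * x + y * y ≡ z * z) × (gcd (gcd x y) z ≡ 1)

module Submission where

-- A palindrome's leading decimal digit equals its units digit, and the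
-- leading digit of a positive number is never 0.  Hence a palindrome
-- divisible by 5 has units digit 5 (not 0), so it starts and ends with 5,
-- and it cannot be even.
--
-- On the other hand, squares modulo 5 are 0, 1 or 4, and the sum of two of
-- 1, 4 is never 1 or 4 modulo 5; so in every Pythagorean triple one of
-- x, y, z is divisible by 5.  It cannot be the even palindrome y, so it is
-- x or z, which then starts and ends with the digit 5.

open import Defs
open import Data.Nat using (ℕ)
open import Data.Nat.Divisibility using (_∣_)
open import Data.Maybe using (just)
open import Data.Product using (_×_)
open import Data.Sum using (_⊎_)
open import Relation.Binary.PropositionalEquality using (_≡_)

open import Data.Nat using (zero; suc; _+_; _*_; _<_; _≤_; s≤s; z≤n)
open import Data.Nat.Properties using (≤-refl; <-≤-trans; <⇒≤pred; ≤⇒≯; m≤m+n)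
open import Data.Nat.DivMod using (_/_; _%_; m%n<n; m/n<m; m/n≡0⇒m<n; m<n⇒m%n≡m; %-distribˡ-*; %-distribˡ-+)
open import Data.Nat.Divisibility using (divides; divides-refl; %-presˡ-∣; m%n≡0⇒n∣m; n∣m⇒m%n≡0)
open import Data.List using (List; []; _∷_; reverse; head; last; _∷ʳ_)
open import Data.List.Properties using (unfold-reverse; reverse-involutive)
open import Data.Maybe.Properties using (just-injective)
open import Data.Product using (_,_)
open import Data.Sum using (inj₁; inj₂)
open import Relation.Nullary using (¬_; contradiction)
open import Relation.Binary.PropositionalEquality using (_≢_; refl; sym; trans; cong; subst; module ≡-Reasoning)

last-∷ʳ : ∀ {A : Set} (xs : List A) (x : A) → last (xs ∷ʳ x) ≡ just x
last-∷ʳ []           x = refl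
last-∷ʳ (_ ∷ [])     x = refl
last-∷ʳ (_ ∷ y ∷ ys) x = last-∷ʳ (y ∷ ys) x

last≡head∘reverse : ∀ {A : Set} (xs : List A) → last xs ≡ head (reverse xs)
last≡head∘reverse xs = begin
  last xs                     ≡⟨ cong last (sym (reverse-involutive xs)) ⟩
  last (reverse (reverse xs)) ≡⟨ last-reverse (reverse xs) ⟩
  head (reverse xs)           ∎
  where
  open ≡-Reasoning
  last-reverse : ∀ {A : Set} (ys : List A) → last (reverse ys) ≡ head ys
  last-reverse []       = refl
  last-reverse (y ∷ ys) = trans (cong last (unfold-reverse y ys)) (last-∷ʳ (reverse ys) y)

last-∷ : ∀ {A : Set} (d : A) (xs : List A) →
  (xs ≡ [] × last (d ∷ xs) ≡ just d) ⊎ last (d ∷ xs) ≡ last xs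
last-∷ d []       = inj₁ (refl , refl)
last-∷ d (_ ∷ _)  = inj₂ refl

lastDigit-units : ∀ n → 0 < n → lastDigit n ≡ just (n % 10)
lastDigit-units (suc _) _ = refl

digitsAux≡[]⇒0 : ∀ f n → n ≤ f → digitsAux f n ≡ [] → n ≡ 0
digitsAux≡[]⇒0 zero    zero    _ _ = refl
digitsAux≡[]⇒0 (suc f) zero    _ _ = refl
digitsAux≡[]⇒0 (suc f) (suc n) _ ()

quotient-≤ : ∀ m f → m ≤ f → suc m / 10 ≤ f
quotient-≤ m f m≤f = <⇒≤pred (<-≤-trans (m/n<m (suc m) 10 (s≤s (s≤s z≤n))) (s≤s m≤f))

single-digit-units≢0 : ∀ m → suc m / 10 ≡ 0 → suc m % 10 ≢ 0
single-digit-units≢0 m quotient≡0 units≡0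
  with trans (sym (m<n⇒m%n≡m {n = 10} {m = suc m} (m/n≡0⇒m<n quotient≡0))) units≡0
... | ()

leading-digit≢0 : ∀ f n → n ≤ f → last (digitsAux f n) ≢ just 0
leading-digit≢0 zero    zero    _ ()
leading-digit≢0 (suc f) zero    _ ()
leading-digit≢0 (suc f) (suc m) (s≤s m≤f) last≡0
  with last-∷ (suc m % 10) (digitsAux f (suc m / 10))
... | inj₂ same =
  leading-digit≢0 f (suc m / 10) (quotient-≤ m f m≤f) (trans (sym same) last≡0)
... | inj₁ (rest≡[] , last≡units) =
  single-digit-units≢0 m (digitsAux≡[]⇒0 f (suc m / 10) (quotient-≤ m f m≤f) rest≡[])
    (just-injective (trans (sym last≡units) last≡0))

palindrome-first≡last : ∀ n → IsPalindrome n → firstDigit n ≡ lastDigit n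
palindrome-first≡last n (_ , rev≡) = trans (last≡head∘reverse (digits n)) (cong head rev≡)

palindrome-units≢0 : ∀ n → IsPalindrome n → n % 10 ≢ 0
palindrome-units≢0 n@(suc _) p units≡0 =
  leading-digit≢0 n n ≤-refl (trans (palindrome-first≡last n p) (cong just units≡0))

multiple-of-5-below-10 : ∀ r → r < 10 → 5 ∣ r → r ≡ 0 ⊎ r ≡ 5
multiple-of-5-below-10 .(0 * 5) _ (divides-refl 0) = inj₁ refl
multiple-of-5-below-10 .(1 * 5) _ (divides-refl 1) = inj₂ refl
multiple-of-5-below-10 .(suc (suc k) * 5) r<10 (divides-refl (suc (suc k))) =
  contradiction r<10 (≤⇒≯ (m≤m+n 10 (k * 5)))

palindrome-units≡5 : ∀ n → IsPalindrome n → 5 ∣ n → n % 10 ≡ 5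
palindrome-units≡5 n p 5∣n with multiple-of-5-below-10 (n % 10) (m%n<n n 10) (%-presˡ-∣ 5∣n (divides 2 refl))
... | inj₁ units≡0 = contradiction units≡0 (palindrome-units≢0 n p)
... | inj₂ units≡5 = units≡5

palindrome-starts-and-ends-with-5 : ∀ n → IsPalindrome n → 5 ∣ n →
  (firstDigit n ≡ just 5) × (lastDigit n ≡ just 5)
palindrome-starts-and-ends-with-5 n p@(0<n , _) 5∣n =
  trans (palindrome-first≡last n p) ends-with-5 , ends-with-5
  where
  ends-with-5 : lastDigit n ≡ just 5
  ends-with-5 = trans (lastDigit-units n 0<n) (cong just (palindrome-units≡5 n p 5∣n))

-- An even palindrome is not divisible by 5: it would end in 5.
even-palindrome-not-multiple-of-5 : ∀ n → IsPalindrome n → 2 ∣ n → ¬ 5 ∣ n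
even-palindrome-not-multiple-of-5 n p 2∣n 5∣n with
  n∣m⇒m%n≡0 5 2 (subst (2 ∣_) (palindrome-units≡5 n p 5∣n) (%-presˡ-∣ 2∣n (divides 5 refl)))
... | ()

NonzeroSquareMod5 : ℕ → Set
NonzeroSquareMod5 r = r ≡ 1 ⊎ r ≡ 4

square-of-residue : ∀ r → r < 5 → r ≡ 0 ⊎ NonzeroSquareMod5 (r * r % 5)
square-of-residue 0 _ = inj₁ refl
square-of-residue 1 _ = inj₂ (inj₁ refl)
square-of-residue 2 _ = inj₂ (inj₂ refl)
square-of-residue 3 _ = inj₂ (inj₂ refl)
square-of-residue 4 _ = inj₂ (inj₁ refl)
square-of-residue (suc (suc (suc (suc (suc k))))) r<5 = contradiction r<5 (≤⇒≯ (m≤m+n 5 k))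

square-mod-5 : ∀ n → 5 ∣ n ⊎ NonzeroSquareMod5 (n * n % 5)
square-mod-5 n with square-of-residue (n % 5) (m%n<n n 5)
... | inj₁ r≡0 = inj₁ (m%n≡0⇒n∣m n 5 r≡0)
... | inj₂ sq  = inj₂ (subst NonzeroSquareMod5 (sym (%-distribˡ-* n n 5)) sq)

nonzero-squares-sum : ∀ {a b c} → NonzeroSquareMod5 a → NonzeroSquareMod5 b →
  NonzeroSquareMod5 c → (a + b) % 5 ≢ c
nonzero-squares-sum (inj₁ refl) (inj₁ refl) (inj₁ refl) ()
nonzero-squares-sum (inj₁ refl) (inj₁ refl) (inj₂ refl) ()
nonzero-squares-sum (inj₁ refl) (inj₂ refl) (inj₁ refl) ()
nonzero-squares-sum (inj₁ refl) (inj₂ refl) (inj₂ refl) ()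
nonzero-squares-sum (inj₂ refl) (inj₁ refl) (inj₁ refl) ()
nonzero-squares-sum (inj₂ refl) (inj₁ refl) (inj₂ refl) ()
nonzero-squares-sum (inj₂ refl) (inj₂ refl) (inj₁ refl) ()
nonzero-squares-sum (inj₂ refl) (inj₂ refl) (inj₂ refl) ()

pythagorean-side-divisible-by-5 : ∀ x y z → x * x + y * y ≡ z * z → 5 ∣ x ⊎ (5 ∣ y ⊎ 5 ∣ z)
pythagorean-side-divisible-by-5 x y z pyth with square-mod-5 x | square-mod-5 y | square-mod-5 z
... | inj₁ 5∣x | _        | _        = inj₁ 5∣x
... | inj₂ _   | inj₁ 5∣y | _        = inj₂ (inj₁ 5∣y)
... | inj₂ _   | inj₂ _   | inj₁ 5∣z = inj₂ (inj₂ 5∣z)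
... | inj₂ sx  | inj₂ sy  | inj₂ sz  = contradiction sum-mod-5 (nonzero-squares-sum sx sy sz)
  where
  open ≡-Reasoning
  sum-mod-5 : (x * x % 5 + y * y % 5) % 5 ≡ z * z % 5
  sum-mod-5 = begin
    (x * x % 5 + y * y % 5) % 5 ≡⟨ sym (%-distribˡ-+ (x * x) (y * y) 5) ⟩
    (x * x + y * y) % 5         ≡⟨ cong (_% 5) pyth ⟩
    z * z % 5                   ∎

corollary4p4 : (x y z : ℕ) → IsPrimitivePythagoreanTriple x y z → 2 ∣ y →
    IsPalindrome x → IsPalindrome y → IsPalindrome z →
    ((firstDigit x ≡ just 5) × (lastDigit x ≡ just 5))
      ⊎ ((firstDigit z ≡ just 5) × (lastDigit z ≡ just 5))
corollary4p4 x y z (_ , _ , _ , pyth , _) 2∣y px py pz with pythagorean-side-divisible-by-5 x y z pyth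
... | inj₁ 5∣x        = inj₁ (palindrome-starts-and-ends-with-5 x px 5∣x)
... | inj₂ (inj₁ 5∣y) = contradiction 5∣y (even-palindrome-not-multiple-of-5 y py 2∣y)
... | inj₂ (inj₂ 5∣z) = inj₂ (palindrome-starts-and-ends-with-5 z pz 5∣z)
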